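{- Let $(X,d)$ be a metric space, $P\subseteq X$ a set of $n$ points, $1\le k\le n$, $\alpha\ge1$, $\mathcal{B}$ a set of critical balls of $P$, $O\subseteq P$ with $|O|=k$ an $\alpha$-fair set of minimum $k$-median cost among $\alpha$-fair sets of $k$ centers, and $S\subseteq P$ with $|S|=k$ a $(t,\varepsilon)$-stable set with respect to $\mathcal{B}$, with $S\cap O=\emptyset$. Let $\mathcal{F}$ be the set of safe points in $\mathcal{NN}_0$. Then $$|\mathcal{F}|\ \ge\ \sum_{s\in S}\max\{0,\ |\mathrm{NN}^{ -1}(s)|-2\}.$$
   Context: $B(x,r)=\{y\in P:d(x,y)\le r\}$, $d(x,Y)=\min_{y\in Y}d(x,y)$, $r_k(x)=\min\{r\ge0:|B(x,r)|\ge n/k\}$; a set is $\alpha$-fair if $d(x,\cdot)\le\alpha r_k(x)$ for all $x\in P$; $\mathrm{cost}(S)=\sum_{x\in P}d(x,S)$. Critical balls: $B_i=B(c_i,\alpha r_k(c_i))$, $c_i\in P$, $i\le\ell\le k$, with (C1) $d(x,\{c_1,\dots,c_\ell\})\le6\alpha r_k(x)$ for all $x\in P$ and (C2) $d(c_i,c_j)>6\alpha\max\{r_k(c_i),r_k(c_j)\}$ for $i\ne j$ (so the balls are pairwise disjoint). $S$ is feasible if it meets every critical ball; a feasible $S$ with $|S|=k$ is $(t,\varepsilon)$-stable if no $T_1\subseteq S$, $T_2\subseteq P\setminus S$ with $|T_1|=|T_2|\le t$ give a feasible $(S\cup T_2)\setminus T_1$ of cost at most $(1-\varepsilon)\mathrm{cost}(S)$.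 For $o\in O$, $\mathrm{NN}_S(o)$ is a (fixed) nearest point of $S$ to $o$; $\mathrm{NN}^{ -1}(s)=\{o\in O:\mathrm{NN}_S(o)=s\}$; $\mathcal{NN}_i=\{s\in S:|\mathrm{NN}^{ -1}(s)|=i\}$, $\mathcal{NN}_{\ge i}=\{s\in S:|\mathrm{NN}^{ -1}(s)|\ge i\}$. A critical ball $B$ is safe if $|B\cap S|\ge2$ or there is $o\in B\cap O$ with $\mathrm{NN}_S(o)\in\mathcal{NN}_1$. A point $s\in S$ is safe if $s\notin\mathcal{NN}_{\ge2}$ and either $s$ lies in no critical ball or the critical ball containing $s$ is safe.
   Formalization: The distances of the metric d on P and the parameters α and ε take rational values. -}

module Defs where

open import Data.Nat as ℕ using (ℕ; _∸_)
open import Data.Fin using (Fin)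
open import Data.Fin.Subset using (Subset; _∈_; _∩_; ∣_∣)
open import Data.Fin.Subset.Properties using (_∈?_)
open import Data.Fin.Properties using (_≟_)
open import Data.List using (List; []; _∷_; map; filter; foldr; allFin)
open import Data.Integer using (+_)
open import Data.Rational as ℚ using (ℚ; 0ℚ; 1ℚ; _+_; _*_; _-_; _⊔_; _⊓_; _≤_; _<_)
open import Data.Rational.Properties using (_≤?_)
open import Data.Vec using (tabulate)
import Data.Nat.ListAction
open import Data.Bool using (_∧_)
open import Data.Product using (_×_; ∃; ∃-syntax; Σ-syntax)
open import Data.Sum using (_⊎_)
open import Relation.Nullary using (¬_; does)
open import Relation.Binary.PropositionalEquality using (_≡_; _≢_)

-- The finite point set P is Fin n; d is a (ℚ-valued) metric on P.
Dist : ℕ → Set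
Dist n = Fin n → Fin n → ℚ

IsMetric : (n : ℕ) → Dist n → Set
IsMetric n d =
  (∀ x y → 0ℚ ≤ d x y) ×
  (∀ x y → d x y ≡ 0ℚ → x ≡ y) ×
  (∀ x → d x x ≡ 0ℚ) ×
  (∀ x y → d x y ≡ d y x) ×
  (∀ x y z → d x z ≤ d x y + d y z)

sumℚ : List ℚ → ℚ
sumℚ = foldr _+_ 0ℚ

-- minimum of a list of rationals (default 0 for the empty list; only used on nonempty sets)
minℚ : List ℚ → ℚ
minℚ []       = 0ℚ
minℚ (x ∷ []) = x
minℚ (x ∷ xs) = x ⊓ minℚ xs

elems : {n : ℕ} → Subset n → List (Fin n)
elems Y = filter (_∈? Y) (allFin _)

distTo : {n : ℕ} → Dist n → Subset n → Fin n → ℚ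
distTo d Y x = minℚ (map (d x) (elems Y))

cost : {n : ℕ} → Dist n → Subset n → ℚ
cost {n} d S = sumℚ (map (distTo d S) (allFin n))

ball : {n : ℕ} → Dist n → Fin n → ℚ → Subset n
ball d x r = tabulate (λ y → does (d x y ≤? r))

-- r is r_k(x) = min { r ≥ 0 : |B(x,r)| ≥ n/k }   (|B| ≥ n/k written as n ≤ k·|B|)
IsRk : (n k : ℕ) → Dist n → Fin n → ℚ → Set
IsRk n k d x r =
  (0ℚ ≤ r) × (n ℕ.≤ k ℕ.* ∣ ball d x r ∣) ×
  (∀ r′ → 0ℚ ≤ r′ → n ℕ.≤ k ℕ.* ∣ ball d x r′ ∣ → r ≤ r′)

Fair : {n : ℕ} → Dist n → (rk : Fin n → ℚ) → ℚ → Subset n → Set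
Fair {n} d rk α S = ∀ (x : Fin n) → distTo d S x ≤ α * rk x

six : ℚ
six = (+ 6) ℚ./ 1

record CriticalBalls (n k : ℕ) (d : Dist n) (rk : Fin n → ℚ) (α : ℚ) : Set where
  field
    ℓ   : ℕ
    ℓ≤k : ℓ ℕ.≤ k
    c   : Fin ℓ → Fin n
    C1  : ∀ x → ∃[ i ] (d x (c i) ≤ six * α * rk x)
    C2  : ∀ i j → i ≢ j → six * α * (rk (c i) ⊔ rk (c j)) < d (c i) (c j)

module _ {n k : ℕ} {d : Dist n} {rk : Fin n → ℚ} {α : ℚ} (𝓑 : CriticalBalls n k d rk α) where
  open CriticalBalls 𝓑

  critBall : Fin ℓ → Subset n
  critBall i = ball d (c i) (α * rk (c i))

  Feasible : Subset n → Set
  Feasible S = ∀ i → ∃[ y ] (y ∈ S × y ∈ critBall i)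

  Stable : ℕ → ℚ → Subset n → Set
  Stable t ε S =
    Feasible S × ∣ S ∣ ≡ k ×
    (∀ (T₁ T₂ : Subset n) →
       (∀ {x} → x ∈ T₁ → x ∈ S) →
       (∀ {x} → x ∈ T₂ → ¬ (x ∈ S)) →
       ∣ T₁ ∣ ≡ ∣ T₂ ∣ → ∣ T₁ ∣ ℕ.≤ t →
       Feasible ((S Data.Fin.Subset.∪ T₂) Data.Fin.Subset.─ T₁) →
       ¬ (cost d ((S Data.Fin.Subset.∪ T₂) Data.Fin.Subset.─ T₁) ≤ (1ℚ - ε) * cost d S))

  IsNN : Subset n → Subset n → (Fin n → Fin n) → Set
  IsNN S O nn = ∀ o → o ∈ O → (nn o ∈ S) × (∀ y → y ∈ S → d o (nn o) ≤ d o y)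

  module _ (S O : Subset n) (nn : Fin n → Fin n) where
    NNinv : Fin n → Subset n
    NNinv s = tabulate (λ o → does (o ∈? O) ∧ does (nn o ≟ s))

    cnt : Fin n → ℕ
    cnt s = ∣ NNinv s ∣

    InNN : ℕ → Fin n → Set
    InNN i s = s ∈ S × cnt s ≡ i

    InNN≥ : ℕ → Fin n → Set
    InNN≥ i s = s ∈ S × i ℕ.≤ cnt s

    SafeBall : Fin ℓ → Set
    SafeBall i = 2 ℕ.≤ ∣ critBall i ∩ S ∣
               ⊎ ∃[ o ] (o ∈ critBall i × o ∈ O × InNN 1 (nn o))

    SafePoint : Fin n → Set
    SafePoint s = s ∈ S × ¬ InNN≥ 2 s × (∀ i → s ∈ critBall i → SafeBall i)

    excess : ℕ
    excess = Data.Nat.ListAction.sum (map (λ s → cnt s ∸ 2) (elems S))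

{-# OPTIONS --safe #-}
-- Every o ∈ O has exactly one nearest neighbour in S, so Σ_{s∈S} |NN⁻¹(s)| = |O| = |S|, and sorting
-- the points of S by |NN⁻¹(s)| ∈ {0, 1, ≥ 2} gives |𝒩𝒩₀| = Σ_s max{0, |NN⁻¹(s)| − 2} + |𝒩𝒩_{≥2}|.
-- It therefore suffices to inject the unsafe points of 𝒩𝒩₀ into 𝒩𝒩_{≥2}. Such a point s lies in an
-- unsafe critical ball Bᵢ, which contains some oᵢ ∈ O because O is fair; send s to NN_S(oᵢ), which is
-- in 𝒩𝒩_{≥2} since Bᵢ is unsafe. Two balls with the same image would have centres within
-- 6α·max r_k of each other by the triangle inequality, contradicting (C2); and an unsafe ball
-- contains only one point of S.
module Submission where

open import Defs
open import Data.Nat using (ℕ; _≤_; _≥_)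
open import Data.Fin using (Fin)
open import Data.Fin.Subset using (Subset; _∈_; _∩_; ∣_∣; Empty)
open import Data.Rational using (ℚ; 1ℚ)
open import Data.Product using (_×_)
open import Relation.Binary.PropositionalEquality using (_≡_)
open import Function.Bundles using (_⇔_)

open import Data.Nat using (zero; suc; _+_; _*_; _∸_; z≤n; s≤s; _≤?_)
import Data.Nat.Properties as ℕₚ
open ℕₚ using (module ≤-Reasoning)
open import Algebra.Properties.CommutativeMonoid.Sum ℕₚ.+-0-commutativeMonoid
  using (sum; sum-syntax; sum-cong-≗; sum-replicate-zero; sum-remove; ∑-comm; ∑-distrib-+)
import Data.Nat.ListAction as ListAction
open import Data.Rational using (0ℚ)
import Data.Rational as ℚ
import Data.Rational.Properties as ℚ
open import Data.Rational.Solver using (module +-*-Solver)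
open import Data.Bool using (Bool; true; false; _∧_; if_then_else_)
open import Data.Fin using (zero; suc; punchIn)
open import Data.Fin.Properties using (_≟_; any?; punchInᵢ≢i)
open import Data.Fin.Subset using (_∉_; Nonempty)
open import Data.Fin.Subset.Properties
  using (_∈?_; x∈p∩q⁺; x∈p⇒∣p-x∣<∣p∣; x∈p∧x≢y⇒x∈p-y; nonempty?; Empty-unique; ∣⊥∣≡0)
open import Data.List using (List; []; _∷_; map; filter; allFin)
import Data.List as List
open import Data.List.Relation.Unary.Any using (here; there)
open import Data.List.Membership.Propositional using () renaming (_∈_ to _∈ₗ_)
open import Data.List.Membership.Propositional.Properties using (∈-map⁺; ∈-map⁻; ∈-filter⁺; ∈-filter⁻; ∈-allFin)
open import Data.Vec using (tabulate; []; _∷_)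
open import Data.Vec.Properties using (lookup∘tabulate; []=⇒lookup; lookup⇒[]=)
open import Data.Product using (_,_; proj₁; proj₂; ∃-syntax)
open import Data.Sum using (inj₁; inj₂)
open import Function using (id; _∘_)
open import Function.Bundles using (Equivalence)
open import Level using (Level)
open import Relation.Nullary using (Dec; yes; no; does; ¬_; contradiction)
open import Relation.Nullary.Decidable using (T?; _×-dec_; _⊎-dec_; ¬?; dec-true; decidable-stable)
open import Relation.Unary using (Pred; Decidable)
open import Relation.Binary.PropositionalEquality using (_≢_; refl; sym; trans; cong; cong₂; subst; module ≡-Reasoning)

private variable
  a b e : Level
  A : Set a

𝟙 : Dec A → ℕ
𝟙 A? = if does A? then 1 else 0

count : ∀ {n} {P : Pred (Fin n) a} → Decidable P → ℕ
count {n = n} P? = ∑[ i < n ] 𝟙 (P? i)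

∑-mono-≤ : ∀ {n} {f g : Fin n → ℕ} → (∀ i → f i ≤ g i) → sum f ≤ sum g
∑-mono-≤ {zero}  f≤g = z≤n
∑-mono-≤ {suc n} f≤g = ℕₚ.+-mono-≤ (f≤g zero) (∑-mono-≤ (f≤g ∘ suc))

term≤∑ : ∀ {n} (f : Fin n → ℕ) (i : Fin n) → f i ≤ sum f
term≤∑ {suc n} f i = ℕₚ.≤-trans (ℕₚ.m≤m+n (f i) _) (ℕₚ.≤-reflexive (sym (sum-remove f)))

count-≥1 : ∀ {n} {P : Pred (Fin n) a} (P? : Decidable P) {i : Fin n} → P i → 1 ≤ count P?
count-≥1 P? {i} Pi with P? i | term≤∑ (𝟙 ∘ P?) i
... | yes _  | 1≤count = 1≤count
... | no ¬Pi | _       = contradiction Pi ¬Pi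

count-none : ∀ {n} {P : Pred (Fin n) a} (P? : Decidable P) → (∀ i → ¬ P i) → count P? ≡ 0
count-none {n = n} P? ∄P = trans (sum-cong-≗ 𝟙-no) (sum-replicate-zero n)
  where
  𝟙-no : ∀ i → 𝟙 (P? i) ≡ 0
  𝟙-no i with P? i
  ... | yes Pi = contradiction Pi (∄P i)
  ... | no _   = refl

count≤1 : ∀ {n} {P : Pred (Fin n) a} (P? : Decidable P) →
          (∀ {i j} → P i → P j → i ≡ j) → count P? ≤ 1
count≤1 {n = zero} P? unique = z≤n
count≤1 {n = suc n} {P = P} P? unique with any? P?
... | no ∄P = ℕₚ.≤-trans (ℕₚ.≤-reflexive (count-none P? (λ i Pi → ∄P (i , Pi)))) z≤n
... | yes (i , Pi) = begin
  count P?                                  ≡⟨ sum-remove {i = i} (𝟙 ∘ P?) ⟩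
  𝟙 (P? i) + count (P? ∘ punchIn i)         ≡⟨ cong (𝟙 (P? i) +_) (count-none (P? ∘ punchIn i) punchIn-∉) ⟩
  𝟙 (P? i) + 0                              ≤⟨ ℕₚ.+-monoˡ-≤ 0 (𝟙≤1 (P? i)) ⟩
  1                                         ∎
  where
  open ≤-Reasoning
  punchIn-∉ : ∀ j → ¬ P (punchIn i j)
  punchIn-∉ j P[j] = punchInᵢ≢i i j (unique P[j] Pi)
  𝟙≤1 : (A? : Dec A) → 𝟙 A? ≤ 1
  𝟙≤1 (yes _) = ℕₚ.≤-refl
  𝟙≤1 (no _)  = z≤n

count≤𝟙 : ∀ {n} {P : Pred (Fin n) a} (P? : Decidable P) (A? : Dec A) →
          (∀ {i} → P i → A) → (∀ {i j} → P i → P j → i ≡ j) → count P? ≤ 𝟙 A?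
count≤𝟙 P? (yes _) P⇒A unique = count≤1 P? unique
count≤𝟙 P? (no ¬A) P⇒A unique = ℕₚ.≤-reflexive (count-none P? (λ i → ¬A ∘ P⇒A))

count-≟ : ∀ {n} (i : Fin n) → count (i ≟_) ≡ 1
count-≟ i = ℕₚ.≤-antisym (count≤1 (i ≟_) (λ i≡j i≡j′ → trans (sym i≡j) i≡j′)) (count-≥1 (i ≟_) refl)

count-fibres : ∀ {m n} {P : Pred (Fin m) a} (P? : Decidable P) (f : Fin m → Fin n) →
               ∑[ j < n ] count (λ i → P? i ×-dec (f i ≟ j)) ≡ count P?
count-fibres {n = n} P? f = trans (∑-comm (λ j i → 𝟙 (P? i ×-dec (f i ≟ j)))) (sum-cong-≗ fibre)
  where
  fibre : ∀ i → ∑[ j < n ] 𝟙 (P? i ×-dec (f i ≟ j)) ≡ 𝟙 (P? i)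
  fibre i with P? i
  ... | yes _ = count-≟ (f i)
  ... | no _  = sum-replicate-zero n

count-≤-injection : ∀ {m n} {P : Pred (Fin m) a} {Q : Pred (Fin n) b} {R : Fin m → Fin n → Set e}
                    (P? : Decidable P) (Q? : Decidable Q) (R? : ∀ i j → Dec (R i j)) →
                    (∀ {i} → P i → ∃[ j ] R i j) →
                    (∀ {i j} → P i → R i j → Q j) →
                    (∀ {i i′ j} → P i → P i′ → R i j → R i′ j → i ≡ i′) →
                    count P? ≤ count Q?
count-≤-injection {m = m} {n} P? Q? R? total into injective = begin
  ∑[ i < m ] 𝟙 (P? i)                           ≤⟨ ∑-mono-≤ 𝟙≤image ⟩
  ∑[ i < m ] ∑[ j < n ] 𝟙 (P? i ×-dec R? i j)   ≡⟨ ∑-comm (λ i j → 𝟙 (P? i ×-dec R? i j)) ⟩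
  ∑[ j < n ] ∑[ i < m ] 𝟙 (P? i ×-dec R? i j)   ≤⟨ ∑-mono-≤ preimage≤𝟙 ⟩
  ∑[ j < n ] 𝟙 (Q? j)                           ∎
  where
  open ≤-Reasoning
  𝟙≤image : ∀ i → 𝟙 (P? i) ≤ count (λ j → P? i ×-dec R? i j)
  𝟙≤image i with P? i
  ... | yes Pi = count-≥1 (λ j → yes Pi ×-dec R? i j) (Pi , proj₂ (total Pi))
  ... | no _   = z≤n
  preimage≤𝟙 : ∀ j → count (λ i → P? i ×-dec R? i j) ≤ 𝟙 (Q? j)
  preimage≤𝟙 j = count≤𝟙 (λ i → P? i ×-dec R? i j) (Q? j) (λ (Pi , Rij) → into Pi Rij)
                   (λ (Pi , Rij) (Pi′ , Ri′j) → injective Pi Pi′ Rij Ri′j)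

count-split : ∀ {n} {P Q : Pred (Fin n) a} (P? : Decidable P) (Q? : Decidable Q) →
              (∀ {i} → Q i → P i) → count P? ≡ count Q? + count (λ i → P? i ×-dec ¬? (Q? i))
count-split P? Q? Q⇒P = trans (sum-cong-≗ split) (∑-distrib-+ (𝟙 ∘ Q?) _)
  where
  split : ∀ i → 𝟙 (P? i) ≡ 𝟙 (Q? i) + 𝟙 (P? i ×-dec ¬? (Q? i))
  split i with P? i | Q? i
  ... | yes _  | yes _  = refl
  ... | yes _  | no _   = refl
  ... | no ¬Pi | yes Qi = contradiction (Q⇒P Qi) ¬Pi
  ... | no _   | no _   = refl

count-zeros : ∀ {n} {S : Pred (Fin n) a} (S? : Decidable S) (c : Fin n → ℕ) →
              (∀ {i} → ¬ S i → c i ≡ 0) → sum c ≡ count S? →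
              count (λ i → S? i ×-dec (c i ℕₚ.≟ 0)) ≡
                ∑[ i < n ] (𝟙 (S? i) * (c i ∸ 2)) + count (λ i → S? i ×-dec (2 ≤? c i))
count-zeros {n = n} S? c c-outside ∑c≡∣S∣ = ℕₚ.+-cancelˡ-≡ (count S?) _ _ (begin
  count S? + Z                                    ≡⟨ cong (_+ Z) ∑c≡∣S∣ ⟨
  sum c + Z                                       ≡⟨ ∑-distrib-+ c _ ⟨
  ∑[ i < n ] (c i + 𝟙 (S? i ×-dec (c i ℕₚ.≟ 0)))   ≡⟨ sum-cong-≗ balance ⟩
  ∑[ i < n ] (𝟙 (S? i) + (surplus i + heavy i))   ≡⟨ ∑-distrib-+ (𝟙 ∘ S?) _ ⟩
  count S? + ∑[ i < n ] (surplus i + heavy i)     ≡⟨ cong (count S? +_) (∑-distrib-+ surplus heavy) ⟩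
  count S? + (sum surplus + sum heavy)            ∎)
  where
  open ≡-Reasoning
  Z : ℕ
  Z = count (λ i → S? i ×-dec (c i ℕₚ.≟ 0))
  surplus heavy : Fin n → ℕ
  surplus i = 𝟙 (S? i) * (c i ∸ 2)
  heavy i = 𝟙 (S? i ×-dec (2 ≤? c i))

  balanceℕ : ∀ x → x + 𝟙 (x ℕₚ.≟ 0) ≡ 1 + ((x ∸ 2) + 𝟙 (2 ≤? x))
  balanceℕ 0 = refl
  balanceℕ 1 = refl
  balanceℕ (suc (suc x)) = cong suc (trans (cong suc (ℕₚ.+-identityʳ x)) (ℕₚ.+-comm 1 x))

  balance : ∀ i → c i + 𝟙 (S? i ×-dec (c i ℕₚ.≟ 0)) ≡ 𝟙 (S? i) + (surplus i + heavy i)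
  balance i with S? i
  ... | yes _  = trans (balanceℕ (c i)) (cong (λ e → 1 + (e + 𝟙 (2 ≤? c i))) (sym (ℕₚ.*-identityˡ (c i ∸ 2))))
  ... | no ¬Si = trans (ℕₚ.+-identityʳ (c i)) (c-outside ¬Si)

sum-filter-tabulate : ∀ {p n} {P : Pred A p} (P? : Decidable P) (g : A → ℕ) (h : Fin n → A) →
                      ListAction.sum (map g (filter P? (List.tabulate h))) ≡ ∑[ i < n ] (𝟙 (P? (h i)) * g (h i))
sum-filter-tabulate {n = zero} P? g h = refl
sum-filter-tabulate {n = suc n} P? g h with P? (h zero)
... | yes _ = cong₂ _+_ (sym (ℕₚ.*-identityˡ (g (h zero)))) (sum-filter-tabulate P? g (h ∘ suc))
... | no _  = sum-filter-tabulate P? g (h ∘ suc)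

∣p∣≡count : ∀ {n} (p : Subset n) → ∣ p ∣ ≡ count (_∈? p)
∣p∣≡count []          = refl
∣p∣≡count (true ∷ p)  = cong suc (∣p∣≡count p)
∣p∣≡count (false ∷ p) = ∣p∣≡count p

∣tabulate∣≡count : ∀ {n} (b : Fin n → Bool) → ∣ tabulate b ∣ ≡ count (T? ∘ b)
∣tabulate∣≡count {zero} b = refl
∣tabulate∣≡count {suc n} b with b zero
... | true  = cong suc (∣tabulate∣≡count (b ∘ suc))
... | false = ∣tabulate∣≡count (b ∘ suc)

∈-tabulate⁺ : ∀ {n} {b : Fin n → Bool} {i} → b i ≡ true → i ∈ tabulate b
∈-tabulate⁺ {b = b} {i} bi≡true = lookup⇒[]= i (tabulate b) (trans (lookup∘tabulate b i) bi≡true)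

∈-tabulate⁻ : ∀ {n} {b : Fin n → Bool} {i} → i ∈ tabulate b → b i ≡ true
∈-tabulate⁻ {b = b} {i} i∈b = trans (sym (lookup∘tabulate b i)) ([]=⇒lookup i∈b)

x∈p∧y∈p∧x≢y⇒2≤∣p∣ : ∀ {n} {p : Subset n} {x y} → x ∈ p → y ∈ p → x ≢ y → 2 ≤ ∣ p ∣
x∈p∧y∈p∧x≢y⇒2≤∣p∣ x∈p y∈p x≢y =
  ℕₚ.≤-trans (s≤s (ℕₚ.≤-trans (s≤s z≤n) (x∈p⇒∣p-x∣<∣p∣ (x∈p∧x≢y⇒x∈p-y y∈p (x≢y ∘ sym))))) (x∈p⇒∣p-x∣<∣p∣ x∈p)

1≤∣p∣⇒Nonempty : ∀ {n} {p : Subset n} → 1 ≤ ∣ p ∣ → Nonempty p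
1≤∣p∣⇒Nonempty {n} {p} 1≤∣p∣ with nonempty? p
... | yes ne  = ne
... | no ¬ne = contradiction (subst (1 ≤_) (trans (cong ∣_∣ (Empty-unique ¬ne)) (∣⊥∣≡0 n)) 1≤∣p∣) λ ()

minℚ-∈ : ∀ {x} {xs : List ℚ} → x ∈ₗ xs → minℚ xs ∈ₗ xs
minℚ-∈ {xs = y ∷ []} _ = here refl
minℚ-∈ {xs = y ∷ z ∷ zs} _ with ℚ.⊓-sel y (minℚ (z ∷ zs)) | minℚ-∈ {xs = z ∷ zs} (here refl)
... | inj₁ min≡y | _    = here min≡y
... | inj₂ min≡m | m∈zs = there (subst (_∈ₗ z ∷ zs) (sym min≡m) m∈zs)

distTo-attained : ∀ {n} (d : Dist n) {Y : Subset n} → Nonempty Y → ∀ x → ∃[ y ] (y ∈ Y × d x y ≡ distTo d Y x)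
distTo-attained d {Y} (y₀ , y₀∈Y) x
  with ∈-map⁻ (d x) (minℚ-∈ (∈-map⁺ (d x) (∈-filter⁺ (_∈? Y) (∈-allFin y₀) y₀∈Y)))
... | y , y∈elems , min≡dxy = y , proj₂ (∈-filter⁻ (_∈? Y) {xs = allFin _} y∈elems) , sym min≡dxy

∈-ball⁺ : ∀ {n} {d : Dist n} {x y r} → d x y ℚ.≤ r → y ∈ ball d x r
∈-ball⁺ {d = d} {x} {y} {r} dxy≤r = ∈-tabulate⁺ (dec-true (d x y ℚ.≤? r) dxy≤r)

∈-ball⁻ : ∀ {n} {d : Dist n} {x y r} → y ∈ ball d x r → d x y ℚ.≤ r
∈-ball⁻ {d = d} {x} {y} {r} y∈ball = witness (d x y ℚ.≤? r) (∈-tabulate⁻ y∈ball)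
  where
  witness : (A? : Dec A) → does A? ≡ true → A
  witness (yes a) _ = a

Fair⇒meets-balls : ∀ {n} {d : Dist n} {rk α} {O : Subset n} → Nonempty O → Fair d rk α O →
                   ∀ x → ∃[ o ] (o ∈ O × o ∈ ball d x (α ℚ.* rk x))
Fair⇒meets-balls {d = d} nonempty fair x with distTo-attained d nonempty x
... | o , o∈O , dxo≡distTo = o , o∈O , ∈-ball⁺ {d = d} (subst (ℚ._≤ _) (sym dxo≡distTo) (fair x))

dist-sym : ∀ {n} {d : Dist n} → IsMetric n d → ∀ x y → d x y ≡ d y x
dist-sym (_ , _ , _ , d-sym , _) = d-sym

triangle : ∀ {n} {d : Dist n} → IsMetric n d → ∀ x y z → d x z ℚ.≤ d x y ℚ.+ d y z
triangle (_ , _ , _ , _ , d-triangle) = d-triangle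

nearest-within-3R : ∀ {n} {d : Dist n} → IsMetric n d → ∀ {R c s o v} →
                    d c s ℚ.≤ R → d c o ℚ.≤ R → d o v ℚ.≤ d o s → d c v ℚ.≤ R ℚ.+ (R ℚ.+ R)
nearest-within-3R {d = d} d-metric {R} {c} {s} {o} {v} dcs≤R dco≤R dov≤dos = begin
  d c v                             ≤⟨ triangle d-metric c o v ⟩
  d c o ℚ.+ d o v                   ≤⟨ ℚ.+-monoʳ-≤ (d c o) (ℚ.≤-trans dov≤dos (triangle d-metric o c s)) ⟩
  d c o ℚ.+ (d o c ℚ.+ d c s)       ≡⟨ cong (λ doc → d c o ℚ.+ (doc ℚ.+ d c s)) (dist-sym d-metric o c) ⟩
  d c o ℚ.+ (d c o ℚ.+ d c s)       ≤⟨ ℚ.+-mono-≤ dco≤R (ℚ.+-mono-≤ dco≤R dcs≤R) ⟩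
  R ℚ.+ (R ℚ.+ R)                   ∎
  where open ℚ.≤-Reasoning

module _ {n k} {d : Dist n} {rk : Fin n → ℚ} {α : ℚ} (𝓑 : CriticalBalls n k d rk α) where
  open CriticalBalls 𝓑

  shared-nearest⇒same-ball : IsMetric n d → 0ℚ ℚ.≤ α → ∀ {i j s s′ o o′ v} →
                             s ∈ critBall 𝓑 i → o ∈ critBall 𝓑 i → d o v ℚ.≤ d o s →
                             s′ ∈ critBall 𝓑 j → o′ ∈ critBall 𝓑 j → d o′ v ℚ.≤ d o′ s′ → i ≡ j
  shared-nearest⇒same-ball d-metric 0≤α {i} {j} {v = v} s∈Bᵢ o∈Bᵢ dov≤dos s′∈Bⱼ o′∈Bⱼ do′v≤do′s′ with i ≟ j
  ... | yes i≡j = i≡j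
  ... | no i≢j  = contradiction (ℚ.<-≤-trans (C2 i j i≢j) centres-close) (ℚ.<-irrefl refl)
    where
    open ℚ.≤-Reasoning
    r M : ℚ
    r = rk (c i) ℚ.⊔ rk (c j)
    M = α ℚ.* r
    dᵢ≤M : ∀ {y} → y ∈ critBall 𝓑 i → d (c i) y ℚ.≤ M
    dᵢ≤M {y} y∈Bᵢ = ℚ.≤-trans (∈-ball⁻ {d = d} {c i} {y} y∈Bᵢ)
                             (ℚ.*-monoˡ-≤-nonNeg α {{ℚ.nonNegative 0≤α}} (ℚ.p≤p⊔q (rk (c i)) (rk (c j))))
    dⱼ≤M : ∀ {y} → y ∈ critBall 𝓑 j → d (c j) y ℚ.≤ M
    dⱼ≤M {y} y∈Bⱼ = ℚ.≤-trans (∈-ball⁻ {d = d} {c j} {y} y∈Bⱼ)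
                             (ℚ.*-monoˡ-≤-nonNeg α {{ℚ.nonNegative 0≤α}} (ℚ.p≤q⊔p (rk (c i)) (rk (c j))))
    centres-close : d (c i) (c j) ℚ.≤ six ℚ.* α ℚ.* r
    centres-close = begin
      d (c i) (c j)                                 ≤⟨ triangle d-metric (c i) v (c j) ⟩
      d (c i) v ℚ.+ d v (c j)                       ≡⟨ cong (d (c i) v ℚ.+_) (dist-sym d-metric v (c j)) ⟩
      d (c i) v ℚ.+ d (c j) v                       ≤⟨ ℚ.+-mono-≤
                                                         (nearest-within-3R d-metric (dᵢ≤M s∈Bᵢ) (dᵢ≤M o∈Bᵢ) dov≤dos)
                                                         (nearest-within-3R d-metric (dⱼ≤M s′∈Bⱼ) (dⱼ≤M o′∈Bⱼ) do′v≤do′s′) ⟩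
      (M ℚ.+ (M ℚ.+ M)) ℚ.+ (M ℚ.+ (M ℚ.+ M))       ≡⟨ solve 2 (λ a x → (a :* x :+ (a :* x :+ a :* x)) :+ (a :* x :+ (a :* x :+ a :* x))
                                                                  := con six :* a :* x) refl α r ⟩
      six ℚ.* α ℚ.* r                               ∎
      where open +-*-Solver

module _ {n k} {d : Dist n} {rk : Fin n → ℚ} {α : ℚ} (𝓑 : CriticalBalls n k d rk α)
         {S O : Subset n} {nn : Fin n → Fin n} (isNN : IsNN 𝓑 S O nn) where
  open CriticalBalls 𝓑

  private
    ∣NN⁻¹∣ : Fin n → ℕ
    ∣NN⁻¹∣ = cnt 𝓑 S O nn

  inNN? : ∀ i s → Dec (InNN 𝓑 S O nn i s)
  inNN? i s = (s ∈? S) ×-dec (∣NN⁻¹∣ s ℕₚ.≟ i)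

  inNN≥? : ∀ i s → Dec (InNN≥ 𝓑 S O nn i s)
  inNN≥? i s = (s ∈? S) ×-dec (i ≤? ∣NN⁻¹∣ s)

  ∣NN⁻¹∣≡count : ∀ s → ∣NN⁻¹∣ s ≡ count (λ o → (o ∈? O) ×-dec (nn o ≟ s))
  ∣NN⁻¹∣≡count s = ∣tabulate∣≡count (λ o → does (o ∈? O) ∧ does (nn o ≟ s))

  ∑∣NN⁻¹∣≡∣O∣ : ∑[ s < n ] ∣NN⁻¹∣ s ≡ ∣ O ∣
  ∑∣NN⁻¹∣≡∣O∣ = trans (sum-cong-≗ ∣NN⁻¹∣≡count) (trans (count-fibres (_∈? O) nn) (sym (∣p∣≡count O)))

  ∉S⇒∣NN⁻¹∣≡0 : ∀ {s} → s ∉ S → ∣NN⁻¹∣ s ≡ 0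
  ∉S⇒∣NN⁻¹∣≡0 {s} s∉S = trans (∣NN⁻¹∣≡count s) (count-none (λ o → (o ∈? O) ×-dec (nn o ≟ s))
    (λ o (o∈O , nn[o]≡s) → s∉S (subst (_∈ S) nn[o]≡s (proj₁ (isNN o o∈O)))))

  1≤∣NN⁻¹∣∘nn : ∀ {o} → o ∈ O → 1 ≤ ∣NN⁻¹∣ (nn o)
  1≤∣NN⁻¹∣∘nn {o} o∈O = subst (1 ≤_) (sym (∣NN⁻¹∣≡count (nn o)))
    (count-≥1 (λ o′ → (o′ ∈? O) ×-dec (nn o′ ≟ nn o)) (o∈O , refl))

  excess≡∑ : excess 𝓑 S O nn ≡ ∑[ s < n ] (𝟙 (s ∈? S) * (∣NN⁻¹∣ s ∸ 2))
  excess≡∑ = sum-filter-tabulate (_∈? S) (λ s → ∣NN⁻¹∣ s ∸ 2) id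

  zeros≡excess+heavy : ∣ O ∣ ≡ ∣ S ∣ → count (inNN? 0) ≡ excess 𝓑 S O nn + count (inNN≥? 2)
  zeros≡excess+heavy ∣O∣≡∣S∣ =
    trans (count-zeros (_∈? S) ∣NN⁻¹∣ ∉S⇒∣NN⁻¹∣≡0 (trans ∑∣NN⁻¹∣≡∣O∣ (trans ∣O∣≡∣S∣ (∣p∣≡count S))))
          (cong (_+ count (inNN≥? 2)) (sym excess≡∑))

  zero⇒¬heavy : ∀ {s} → InNN 𝓑 S O nn 0 s → ¬ InNN≥ 𝓑 S O nn 2 s
  zero⇒¬heavy (_ , ∣NN⁻¹∣≡0) (_ , 2≤∣NN⁻¹∣) = contradiction (subst (2 ≤_) ∣NN⁻¹∣≡0 2≤∣NN⁻¹∣) λ ()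

  safeBall? : ∀ i → Dec (SafeBall 𝓑 S O nn i)
  safeBall? i = (2 ≤? ∣ critBall 𝓑 i ∩ S ∣) ⊎-dec
                any? (λ o → (o ∈? critBall 𝓑 i) ×-dec (o ∈? O) ×-dec inNN? 1 (nn o))

  ¬safe⇒unsafe-ball : ∀ {s} → ¬ (∀ i → s ∈ critBall 𝓑 i → SafeBall 𝓑 S O nn i) →
                ∃[ i ] (s ∈ critBall 𝓑 i × ¬ SafeBall 𝓑 S O nn i)
  ¬safe⇒unsafe-ball {s} ¬safe with any? (λ i → (s ∈? critBall 𝓑 i) ×-dec ¬? (safeBall? i))
  ... | yes found = found
  ... | no ∄      = contradiction (λ i s∈Bᵢ → decidable-stable (safeBall? i) (λ ¬safeᵢ → ∄ (i , s∈Bᵢ , ¬safeᵢ))) ¬safe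

  module _ (d-metric : IsMetric n d) (0≤α : 0ℚ ℚ.≤ α)
           (O-meets : ∀ i → ∃[ o ] (o ∈ O × o ∈ critBall 𝓑 i)) where

    private
      oᵢ : Fin ℓ → Fin n
      oᵢ i = proj₁ (O-meets i)

      oᵢ∈O : ∀ i → oᵢ i ∈ O
      oᵢ∈O i = proj₁ (proj₂ (O-meets i))

      oᵢ∈Bᵢ : ∀ i → oᵢ i ∈ critBall 𝓑 i
      oᵢ∈Bᵢ i = proj₂ (proj₂ (O-meets i))

      nn-nearest : ∀ i {s} → s ∈ S → d (oᵢ i) (nn (oᵢ i)) ℚ.≤ d (oᵢ i) s
      nn-nearest i {s} s∈S = proj₂ (isNN (oᵢ i) (oᵢ∈O i)) s s∈S

    PointsTo : Fin n → Fin n → Set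
    PointsTo s v = ∃[ i ] (s ∈ critBall 𝓑 i × ¬ SafeBall 𝓑 S O nn i × nn (oᵢ i) ≡ v)

    pointsTo? : ∀ s v → Dec (PointsTo s v)
    pointsTo? s v = any? (λ i → (s ∈? critBall 𝓑 i) ×-dec ¬? (safeBall? i) ×-dec (nn (oᵢ i) ≟ v))

    unsafe-zero-pointsTo : ∀ {s} → InNN 𝓑 S O nn 0 s → ¬ SafePoint 𝓑 S O nn s → ∃[ v ] PointsTo s v
    unsafe-zero-pointsTo inNN₀ unsafe =
      let (i , s∈Bᵢ , unsafeᵢ) = ¬safe⇒unsafe-ball (λ safe → unsafe (proj₁ inNN₀ , zero⇒¬heavy inNN₀ , safe))
      in nn (oᵢ i) , i , s∈Bᵢ , unsafeᵢ , refl

    pointsTo-heavy : ∀ {s v} → PointsTo s v → InNN≥ 𝓑 S O nn 2 v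
    pointsTo-heavy (i , _ , unsafeᵢ , refl) =
      nn[oᵢ]∈S , ℕₚ.≤∧≢⇒< (1≤∣NN⁻¹∣∘nn (oᵢ∈O i))
                   (λ 1≡∣NN⁻¹∣ → unsafeᵢ (inj₂ (oᵢ i , oᵢ∈Bᵢ i , oᵢ∈O i , nn[oᵢ]∈S , sym 1≡∣NN⁻¹∣)))
      where
      nn[oᵢ]∈S : nn (oᵢ i) ∈ S
      nn[oᵢ]∈S = proj₁ (isNN (oᵢ i) (oᵢ∈O i))

    pointsTo-injective : ∀ {s s′ v} → s ∈ S → s′ ∈ S → PointsTo s v → PointsTo s′ v → s ≡ s′
    pointsTo-injective {s} {s′} s∈S s′∈S (i , s∈Bᵢ , unsafeᵢ , refl) (j , s′∈Bⱼ , _ , nn[oⱼ]≡v)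
      with shared-nearest⇒same-ball 𝓑 d-metric 0≤α s∈Bᵢ (oᵢ∈Bᵢ i) (nn-nearest i s∈S) s′∈Bⱼ (oᵢ∈Bᵢ j)
             (subst (λ v → d (oᵢ j) v ℚ.≤ d (oᵢ j) s′) nn[oⱼ]≡v (nn-nearest j s′∈S))
    ... | refl = decidable-stable (s ≟ s′) (λ s≢s′ →
      unsafeᵢ (inj₁ (x∈p∧y∈p∧x≢y⇒2≤∣p∣ (x∈p∩q⁺ (s∈Bᵢ , s∈S)) (x∈p∩q⁺ (s′∈Bⱼ , s′∈S)) s≢s′)))

    unsafe-zeros≤heavy : ∀ {U : Pred (Fin n) a} (U? : Decidable U) →
                         (∀ {s} → U s → InNN 𝓑 S O nn 0 s × ¬ SafePoint 𝓑 S O nn s) →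
                         count U? ≤ count (inNN≥? 2)
    unsafe-zeros≤heavy {U = U} U? U⇒unsafe-zero =
      count-≤-injection U? (inNN≥? 2) pointsTo?
        (λ Us → let (inNN₀ , unsafe) = U⇒unsafe-zero Us in unsafe-zero-pointsTo inNN₀ unsafe)
        (λ _ → pointsTo-heavy)
        (λ Us Us′ → pointsTo-injective (s∈S Us) (s∈S Us′))
      where
      s∈S : ∀ {s} → U s → s ∈ S
      s∈S Us = proj₁ (proj₁ (U⇒unsafe-zero Us))

lemma4 : (n k : ℕ) → 1 ≤ k → k ≤ n →
    (d : Dist n) → IsMetric n d →
    (rk : Fin n → ℚ) → (∀ x → IsRk n k d x (rk x)) →
    (α : ℚ) → 1ℚ Data.Rational.≤ α →
    (𝓑 : CriticalBalls n k d rk α) →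
    (O : Subset n) → ∣ O ∣ ≡ k → Fair d rk α O →
    (∀ (O′ : Subset n) → ∣ O′ ∣ ≡ k → Fair d rk α O′ → cost d O Data.Rational.≤ cost d O′) →
    (t : ℕ) (ε : ℚ) (S : Subset n) → Stable 𝓑 t ε S →
    Empty (S ∩ O) →
    (nn : Fin n → Fin n) → IsNN 𝓑 S O nn →
    (F : Subset n) →
    (∀ s → s ∈ F ⇔ (InNN 𝓑 S O nn 0 s × SafePoint 𝓑 S O nn s)) →
    ∣ F ∣ ≥ excess 𝓑 S O nn
lemma4 _ _ 1≤k _ _ d-metric rk _ α 1≤α 𝓑 O ∣O∣≡k O-fair _ _ _ S (_ , ∣S∣≡k , _) _ nn isNN F F⇔ =
  ℕₚ.+-cancelʳ-≤ heavy (excess 𝓑 S O nn) ∣ F ∣ (begin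
    excess 𝓑 S O nn + heavy              ≡⟨ zeros≡excess+heavy 𝓑 isNN (trans ∣O∣≡k (sym ∣S∣≡k)) ⟨
    count (inNN? 𝓑 isNN 0)               ≡⟨ count-split (inNN? 𝓑 isNN 0) (_∈? F) (proj₁ ∘ Equivalence.to (F⇔ _)) ⟩
    count (_∈? F) + count unsafe-zero?   ≤⟨ ℕₚ.+-monoʳ-≤ (count (_∈? F))
                                              (unsafe-zeros≤heavy 𝓑 isNN d-metric 0≤α O-meets unsafe-zero? unsafe-zero) ⟩
    count (_∈? F) + heavy                ≡⟨ cong (_+ heavy) (∣p∣≡count F) ⟨
    ∣ F ∣ + heavy                        ∎)
  where
  open ≤-Reasoning
  heavy : ℕ
  heavy = count (inNN≥? 𝓑 isNN 2)
  0≤α : 0ℚ ℚ.≤ α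
  0≤α = ℚ.≤-trans (ℚ.nonNegative⁻¹ 1ℚ) 1≤α
  -- 1 ≤ k is needed here: distTo to the empty set is 0 (minℚ [] = 0), so ∅ is vacuously fair.
  O-meets : ∀ i → ∃[ o ] (o ∈ O × o ∈ critBall 𝓑 i)
  O-meets i = Fair⇒meets-balls {rk = rk} {α} (1≤∣p∣⇒Nonempty (subst (1 ≤_) (sym ∣O∣≡k) 1≤k)) O-fair
                                (CriticalBalls.c 𝓑 i)
  unsafe-zero? : Decidable (λ s → InNN 𝓑 S O nn 0 s × ¬ s ∈ F)
  unsafe-zero? s = inNN? 𝓑 isNN 0 s ×-dec ¬? (s ∈? F)
  unsafe-zero : ∀ {s} → InNN 𝓑 S O nn 0 s × ¬ s ∈ F → InNN 𝓑 S O nn 0 s × ¬ SafePoint 𝓑 S O nn s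
  unsafe-zero (inNN₀ , s∉F) = inNN₀ , λ safe → s∉F (Equivalence.from (F⇔ _) (inNN₀ , safe))
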